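{- Let $p>2$ be a prime, $M=M[A]$ a simple, coloopless $p$-matroid on ground set $E$, $a,b\in E$ distinct, $\alpha\in GF(p)$ nonzero, and $e=b$. Then the $es$-splitting matroid $M^e_{a,b}$ is Eulerian if and only if there exists a collection of circuits $\{C_{np},C_1,\dots,C_k\}$ of $M$, where $C_{np}$ is an $np$-circuit containing $a$ and $b$, such that $E=C_{np}\cup C_1\cup\dots\cup C_k$ and the circuits in the collection are pairwise disjoint except that $C_{np}\cap C_1=\{b\}$.
   Context: A $p$-matroid is a matroid representable over $GF(p)$, $A$ a representing matrix over $GF(p)$ with columns indexed by $E$. $A'_{a,b}$ is obtained from $A$ by appending a last row with $\alpha$ in columns $a,b$ and $0$ elsewhere, then a column $z$ with last coordinate $\alpha$ and $0$ elsewhere. $A^e_{a,b}$ is obtained from $A'_{a,b}$ by appending a column $\gamma$ = (column of $e$) $-$ (column $z$); $M^e_{a,b}$ is the vector matroid of $A^e_{a,b}$ on $E\cup\{z,\gamma\}$. For a circuit $C$ of $M$ let $c_u$ ($u\in C$) be nonzero scalars, unique up to common factor, with $\sum c_uu=0$; $C$ is an $np$-circuit if $|C\cap\{a,b\}|=1$, or $\{a,b\}\subseteq C$ and $c_a+c_b\neq 0$. A matroid is Eulerian if its ground set is a disjoint union of circuits. -}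

module Defs where

open import Data.Nat using (ℕ; zero; suc; _≤_)
open import Data.Integer using (ℤ; +_; _+_; _-_; _*_)
open import Data.Integer.Divisibility using (_∣_)
open import Data.Fin using (Fin; zero; suc) renaming (_≟_ to _≟ᶠ_)
open import Data.Fin.Subset using (Subset; _∈_; _∉_; _⊂_; ∣_∣)
open import Data.Bool using (if_then_else_; _∨_)
open import Data.List using (List)
open import Data.List.Relation.Unary.All using (All)
open import Data.List.Relation.Unary.Any using (Any)
open import Data.List.Relation.Unary.AllPairs using (AllPairs)
open import Data.Product using (Σ; ∃; _×_)
open import Data.Sum using (_⊎_)
open import Data.Empty using (⊥)
open import Relation.Nullary using (¬_; does)
open import Relation.Binary.PropositionalEquality using (_≡_)

-- Elements of GF(p) are represented by integers, compared modulo p.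
infix 4 _≡_[mod_]
_≡_[mod_] : ℤ → ℤ → ℕ → Set
x ≡ y [mod p ] = (+ p) ∣ (x - y)

-- An m × n matrix over GF(p) (entries read modulo p); columns indexed by Fin n = E.
Matrix : ℕ → ℕ → Set
Matrix m n = Fin m → Fin n → ℤ

sumFin : ∀ {n} → (Fin n → ℤ) → ℤ
sumFin {zero}  f = + 0
sumFin {suc n} f = f zero + sumFin (λ j → f (suc j))

IsRelation : ∀ {m n} → ℕ → Matrix m n → (Fin n → ℤ) → Set
IsRelation p A c = ∀ i → sumFin (λ j → c j * A i j) ≡ + 0 [mod p ]

Dependent : ∀ {m n} → ℕ → Matrix m n → Subset n → Set
Dependent p A S = Σ (_ → ℤ) λ c →
  IsRelation p A c × (∀ j → j ∉ S → c j ≡ + 0 [mod p ]) ×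
  ∃ λ j → j ∈ S × ¬ (c j ≡ + 0 [mod p ])

Circuit : ∀ {m n} → ℕ → Matrix m n → Subset n → Set
Circuit p A C = Dependent p A C × (∀ D → D ⊂ C → ¬ Dependent p A D)

CircuitCoeffs : ∀ {m n} → ℕ → Matrix m n → Subset n → (Fin n → ℤ) → Set
CircuitCoeffs p A C c =
  IsRelation p A c × (∀ j → (j ∈ C → ¬ (c j ≡ + 0 [mod p ])) × (j ∉ C → c j ≡ + 0 [mod p ]))

NPCircuit : ∀ {m n} → ℕ → Matrix m n → Fin n → Fin n → Subset n → Set
NPCircuit p A a b C = Circuit p A C ×
  ((a ∈ C × b ∉ C) ⊎ (a ∉ C × b ∈ C) ⊎
   (a ∈ C × b ∈ C × Σ (_ → ℤ) λ c → CircuitCoeffs p A C c × ¬ (c a + c b ≡ + 0 [mod p ])))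

-- simple: no loops and no parallel pairs, i.e. every circuit has at least 3 elements
Simple : ∀ {m n} → ℕ → Matrix m n → Set
Simple p A = ∀ C → Circuit p A C → 3 ≤ ∣ C ∣

Coloopless : ∀ {m n} → ℕ → Matrix m n → Set
Coloopless p A = ∀ j → ∃ λ C → Circuit p A C × j ∈ C

Disjoint : ∀ {n} → Subset n → Subset n → Set
Disjoint C D = ∀ j → j ∈ C → j ∈ D → ⊥


Eulerian : ∀ {m n} → ℕ → Matrix m n → Set
Eulerian p A = Σ (List (Subset _)) λ Cs →
  All (Circuit p A) Cs × AllPairs Disjoint Cs × (∀ j → Any (j ∈_) Cs)

-- A'_{a,b}: new last row (here row index zero) with α in columns a,b;
-- new column z (here column index zero) with α in the new row, 0 elsewhere.
-- Row/column order is immaterial for the matroid.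
A′ : ∀ {m n} → Matrix m n → Fin n → Fin n → ℤ → Matrix (suc m) (suc n)
A′ A a b α zero    zero    = α
A′ A a b α zero    (suc j) = if does (j ≟ᶠ a) ∨ does (j ≟ᶠ b) then α else + 0
A′ A a b α (suc i) zero    = + 0
A′ A a b α (suc i) (suc j) = A i j

-- A^e_{a,b}: append column γ = (column e) − (column z); here γ has column index zero,
-- z has index suc zero, and element j ∈ E has index suc (suc j).
Ae : ∀ {m n} → Matrix m n → Fin n → Fin n → ℤ → Fin n → Matrix (suc m) (suc (suc n))
Ae A a b α e i zero    = A′ A a b α i (suc e) - A′ A a b α i zero
Ae A a b α e i (suc k) = A′ A a b α i k

{-# OPTIONS --safe #-}
-- Column γ of A^b_{a,b} is column b minus column z. Hence a coefficient vector d on E ∪ {z, γ} is a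
-- linear relation of A^b_{a,b} iff d_z + d_a + d_b = 0 (the new row, as α ≠ 0 and p is prime) and d with
-- d_γ added to its b-coordinate is a relation of A. Moving relations back and forth along this
-- correspondence matches circuits: a circuit of M avoiding a and b stays a circuit, an np-circuit C ∋ a, b
-- gives the circuit z ∪ C, a circuit C with b ∈ C ∌ a gives γ ∪ (C − b), and conversely circuits of these
-- three shapes come from circuits of M. In a partition of E ∪ {z, γ} into circuits, a and b always lie in
-- the same part, so no part contains both z and γ: it would either contain the dependent set {γ, z, b}
-- properly, or the new row would force d_z = 0. The parts through z and through γ give C_np and C₁, the
-- others the remaining circuits, and the construction reverses. Minimality of a circuit is used in the
-- form: a relation supported on a circuit that vanishes at one of its elements vanishes everywhere.
module Submission where

open import Defs
open import Data.Nat using (ℕ; zero; suc; _<_)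
import Data.Nat.Divisibility as ℕ
open import Data.Nat.Primality using (Prime; euclidsLemma; ¬prime[1])
open import Data.Integer using (ℤ; +_; _+_; _-_; _*_; -_; ∣_∣)
open import Data.Integer.Properties
  using (+-inverseˡ; +-inverseʳ; +-identityˡ; +-identityʳ; +-comm; *-zeroʳ; *-distribˡ-+; neg-involutive; abs-*)
import Data.Integer.Divisibility.Signed as ℤ
open import Data.Integer.Tactic.RingSolver using (solve-∀)
open import Data.Bool using (if_then_else_; _∨_)
open import Data.Fin using (Fin; zero; suc) renaming (_≟_ to _≟ᶠ_)
open import Data.Fin.Subset using (Subset; inside; outside; _∈_; _∉_; _∪_; _─_; ⁅_⁆)
open import Data.Fin.Subset.Properties
  using (_∈?_; drop-there; p─q⊆p; x∈p⇒p-x⊂p; x∈p∧x≢y⇒x∈p-y; x∈p∪q⁺; x∈p∪q⁻; x∈⁅x⁆; x∈⁅y⁆⇒x≡y)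
open import Data.Vec using (_∷_; here; there)
open import Data.List using (List; _∷_; map; filter)
open import Data.List.Relation.Unary.All as All using (All; _∷_)
open import Data.List.Relation.Unary.Any as Any using (Any)
open import Data.List.Relation.Unary.AllPairs as AllPairs using (AllPairs; _∷_)
import Data.List.Relation.Unary.All.Properties as All
import Data.List.Relation.Unary.Any.Properties as Any
import Data.List.Relation.Unary.AllPairs.Properties as AllPairs
open import Data.List.Membership.Propositional using (find; lose) renaming (_∈_ to _∈ₗ_)
open import Data.List.Membership.Propositional.Properties using (∈-map⁺; ∈-filter⁺; ∈-filter⁻)
open import Data.Empty using (⊥-elim)
open import Data.Product using (Σ; _×_; _,_; proj₁; proj₂)
open import Data.Sum using (_⊎_; inj₁; inj₂; [_,_]′)
open import Function using (_∘_; id)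
open import Function.Bundles using (_⇔_; mk⇔)
open import Relation.Nullary using (¬_; Dec; yes; no; map′; does)
open import Relation.Nullary.Decidable using (¬?; _×-dec_)
open import Relation.Binary.Bundles using (Setoid)
open import Relation.Binary.Structures using (IsEquivalence)
import Relation.Binary.Reasoning.Setoid
open import Relation.Binary.PropositionalEquality
  using (_≡_; refl; sym; trans; cong; cong₂; subst; module ≡-Reasoning)

sumFin-+ : ∀ {n} (f g : Fin n → ℤ) → sumFin (λ j → f j + g j) ≡ sumFin f + sumFin g
sumFin-+ {zero} f g = refl
sumFin-+ {suc n} f g =
  trans (cong (_+_ (f zero + g zero)) (sumFin-+ (f ∘ suc) (g ∘ suc))) (interchange (f zero) (g zero) _ _)
  where
  interchange : ∀ a b c d → (a + b) + (c + d) ≡ (a + c) + (b + d)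
  interchange = solve-∀

sumFin-*ˡ : ∀ {n} x (f : Fin n → ℤ) → sumFin (λ j → x * f j) ≡ x * sumFin f
sumFin-*ˡ {zero} x f = sym (*-zeroʳ x)
sumFin-*ˡ {suc n} x f =
  trans (cong (_+_ (x * f zero)) (sumFin-*ˡ x (f ∘ suc))) (sym (*-distribˡ-+ x (f zero) _))


δ : ∀ {n} → Fin n → ℤ → Fin n → ℤ
δ b x j = if does (j ≟ᶠ b) then x else + 0

δ-self : ∀ {n} (b : Fin n) x → δ b x b ≡ x
δ-self b x with b ≟ᶠ b
... | yes _ = refl
... | no b≢b = ⊥-elim (b≢b refl)

δ-other : ∀ {n} {b j : Fin n} x → ¬ j ≡ b → δ b x j ≡ + 0
δ-other {b = b} {j} x j≢b with j ≟ᶠ b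
... | yes j≡b = ⊥-elim (j≢b j≡b)
... | no _ = refl

sumFin-δ : ∀ {n} (b : Fin n) x (g : Fin n → ℤ) → sumFin (λ j → g j * δ b x j) ≡ g b * x
sumFin-δ zero x g = trans (cong (_+_ (g zero * x)) (sumFin-0 (λ j → *-zeroʳ (g (suc j))))) (+-identityʳ _)
  where
  sumFin-0 : ∀ {n} {f : Fin n → ℤ} → (∀ j → f j ≡ + 0) → sumFin f ≡ + 0
  sumFin-0 {zero} f≡0 = refl
  sumFin-0 {suc n} f≡0 = cong₂ _+_ (f≡0 zero) (sumFin-0 (f≡0 ∘ suc))
sumFin-δ (suc b) x g =
  trans (cong (_+ sumFin (λ j → g (suc j) * δ b x j)) (*-zeroʳ (g zero)))
        (trans (+-identityˡ _) (sumFin-δ b x (g ∘ suc)))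

x∉p─⁅x⁆ : ∀ {n} {p : Subset n} x → x ∉ p ─ ⁅ x ⁆
x∉p─⁅x⁆ {p = _ ∷ _} zero ()
x∉p─⁅x⁆ {p = _ ∷ _} (suc x) (there x∈) = x∉p─⁅x⁆ x x∈

meeting⇒≡ : ∀ {n} {Cs : List (Subset n)} → AllPairs Disjoint Cs →
            ∀ {D D′ k} → D ∈ₗ Cs → D′ ∈ₗ Cs → k ∈ D → k ∈ D′ → D ≡ D′
meeting⇒≡ (_ ∷ _) (Any.here refl) (Any.here refl) _ _ = refl
meeting⇒≡ (D#Cs ∷ _) (Any.here refl) (Any.there D′∈) k∈D k∈D′ = ⊥-elim (All.lookup D#Cs D′∈ _ k∈D k∈D′)
meeting⇒≡ (D′#Cs ∷ _) (Any.there D∈) (Any.here refl) k∈D k∈D′ = ⊥-elim (All.lookup D′#Cs D∈ _ k∈D′ k∈D)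
meeting⇒≡ (_ ∷ disjoint) (Any.there D∈) (Any.there D′∈) k∈D k∈D′ = meeting⇒≡ disjoint D∈ D′∈ k∈D k∈D′

module Congruence (p : ℕ) where

  infix 4 _≈_ _≈?_
  -- A record, so that x and y can be recovered by unification: x ≡ y [mod p ] unfolds to a
  -- divisibility statement about ∣ x - y ∣.
  record _≈_ (x y : ℤ) : Set where
    constructor mk≈
    field p∣x-y : x ≡ y [mod p ]
  open _≈_ public

  private
    toSigned : ∀ {x y} → x ≈ y → + p ℤ.∣ x - y
    toSigned = ℤ.∣ᵤ⇒∣ ∘ p∣x-y

    via : ∀ {x y u} → u ≡ x - y → + p ℤ.∣ u → x ≈ y
    via refl = mk≈ ∘ ℤ.∣⇒∣ᵤ

  _≈?_ : ∀ x y → Dec (x ≈ y)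
  x ≈? y = map′ mk≈ p∣x-y (p ℕ.∣? ∣ x - y ∣)

  ≈-reflexive : ∀ {x y} → x ≡ y → x ≈ y
  ≈-reflexive {x} refl = via (sym (+-inverseʳ x)) (ℤ.∣ᵤ⇒∣ (p ℕ.∣0))

  ≈-refl : ∀ {x} → x ≈ x
  ≈-refl = ≈-reflexive refl

  ≈-sym : ∀ {x y} → x ≈ y → y ≈ x
  ≈-sym {x} {y} x≈y = via (identity x y) (ℤ.∣m⇒∣-m (toSigned x≈y))
    where
    identity : ∀ x y → - (x - y) ≡ y - x
    identity = solve-∀

  ≈-trans : ∀ {x y z} → x ≈ y → y ≈ z → x ≈ z
  ≈-trans {x} {y} {z} x≈y y≈z = via (identity x y z) (ℤ.∣m∣n⇒∣m+n (toSigned x≈y) (toSigned y≈z))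
    where
    identity : ∀ x y z → (x - y) + (y - z) ≡ x - z
    identity = solve-∀

  ≈-isEquivalence : IsEquivalence _≈_
  ≈-isEquivalence = record { refl = ≈-refl ; sym = ≈-sym ; trans = ≈-trans }

  ≈-setoid : Setoid _ _
  ≈-setoid = record { isEquivalence = ≈-isEquivalence }

  module ≈-Reasoning = Relation.Binary.Reasoning.Setoid ≈-setoid

  +-cong : ∀ {x y u v} → x ≈ y → u ≈ v → x + u ≈ y + v
  +-cong {x} {y} {u} {v} x≈y u≈v = via (identity x y u v) (ℤ.∣m∣n⇒∣m+n (toSigned x≈y) (toSigned u≈v))
    where
    identity : ∀ x y u v → (x - y) + (u - v) ≡ (x + u) - (y + v)
    identity = solve-∀

  +-congˡ : ∀ x {u v} → u ≈ v → x + u ≈ x + v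
  +-congˡ x = +-cong (≈-refl {x})

  *-congˡ : ∀ k {x y} → x ≈ y → k * x ≈ k * y
  *-congˡ k {x} {y} x≈y = via (identity k x y) (ℤ.∣n⇒∣m*n k (toSigned x≈y))
    where
    identity : ∀ k x y → k * (x - y) ≡ k * x - k * y
    identity = solve-∀

  *-congʳ : ∀ k {x y} → x ≈ y → x * k ≈ y * k
  *-congʳ k {x} {y} x≈y = via (identity k x y) (ℤ.∣n⇒∣m*n k (toSigned x≈y))
    where
    identity : ∀ k x y → k * (x - y) ≡ x * k - y * k
    identity = solve-∀

  -‿cong : ∀ {x y} → x ≈ y → - x ≈ - y
  -‿cong {x} {y} x≈y = via (identity x y) (ℤ.∣m⇒∣-m (toSigned x≈y))
    where
    identity : ∀ x y → - (x - y) ≡ (- x) - (- y)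
    identity = solve-∀

  *≈0⇒≈0⊎≈0 : Prime p → ∀ x y → x * y ≈ + 0 → x ≈ + 0 ⊎ y ≈ + 0
  *≈0⇒≈0⊎≈0 p-prime x y xy≈0 with euclidsLemma ∣ x ∣ ∣ y ∣ p-prime (subst (p ℕ.∣_) (abs-* x y) (absolute xy≈0))
    where
    absolute : ∀ {u} → u ≈ + 0 → p ℕ.∣ ∣ u ∣
    absolute {u} (mk≈ p∣u-0) = subst (λ v → p ℕ.∣ ∣ v ∣) (+-identityʳ u) p∣u-0
  ... | inj₁ p∣x = inj₁ (mk≈ (subst (λ v → p ℕ.∣ ∣ v ∣) (sym (+-identityʳ x)) p∣x))
  ... | inj₂ p∣y = inj₂ (mk≈ (subst (λ v → p ℕ.∣ ∣ v ∣) (sym (+-identityʳ y)) p∣y))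

  1≉0 : Prime p → ¬ (+ 1 ≈ + 0)
  1≉0 p-prime (mk≈ p∣1) = ¬prime[1] (subst Prime (ℕ.∣1⇒≡1 p∣1) p-prime)

  ≈0-* : ∀ k {x} → x ≈ + 0 → k * x ≈ + 0
  ≈0-* k x≈0 = ≈-trans (*-congˡ k x≈0) (≈-reflexive (*-zeroʳ k))

  +≈0⇒≈0ʳ : ∀ {x y} → x + y ≈ + 0 → x ≈ + 0 → y ≈ + 0
  +≈0⇒≈0ʳ {x} {y} x+y≈0 x≈0 =
    ≈-trans (≈-reflexive (identity x y)) (+-cong x+y≈0 (-‿cong x≈0))
    where
    identity : ∀ x y → y ≡ (x + y) + - x
    identity = solve-∀

  +≈0⇒≈0ˡ : ∀ {x y} → x + y ≈ + 0 → y ≈ + 0 → x ≈ + 0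
  +≈0⇒≈0ˡ {x} {y} x+y≈0 = +≈0⇒≈0ʳ (≈-trans (≈-reflexive (+-comm y x)) x+y≈0)

  +≉0⇒≉0⊎≉0 : ∀ x y → ¬ (x + y ≈ + 0) → ¬ (x ≈ + 0) ⊎ ¬ (y ≈ + 0)
  +≉0⇒≉0⊎≉0 x y x+y≉0 with x ≈? + 0
  ... | no x≉0 = inj₁ x≉0
  ... | yes x≈0 = inj₂ (x+y≉0 ∘ +-cong x≈0)

  -≈0⇒≈0 : ∀ {x} → - x ≈ + 0 → x ≈ + 0
  -≈0⇒≈0 {x} -x≈0 = ≈-trans (≈-reflexive (sym (neg-involutive x))) (-‿cong -x≈0)

  -≈0⇒≈ : ∀ {x y} → x - y ≈ + 0 → x ≈ y
  -≈0⇒≈ {x} {y} x-y≈0 = via (+-identityʳ (x - y)) (toSigned x-y≈0)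

  Supported : ∀ {n} → (Fin n → ℤ) → Subset n → Set
  Supported c S = ∀ j → j ∉ S → c j ≈ + 0

  supported⇒∈ : ∀ {n} {c : Fin n → ℤ} {S} → Supported c S → ∀ {j} → ¬ (c j ≈ + 0) → j ∈ S
  supported⇒∈ {S = S} supp {j} cj≉0 with j ∈? S
  ... | yes j∈S = j∈S
  ... | no j∉S = ⊥-elim (cj≉0 (supp j j∉S))

  sumFin-cong : ∀ {n} {f g : Fin n → ℤ} → (∀ j → f j ≈ g j) → sumFin f ≈ sumFin g
  sumFin-cong {zero} f≈g = ≈-refl
  sumFin-cong {suc n} f≈g = +-cong (f≈g zero) (sumFin-cong (f≈g ∘ suc))

module Relations (p : ℕ) {m n : ℕ} (M : Matrix m n) where
  open Congruence p

  row-sum≈0 : ∀ c → IsRelation p M c → ∀ i → sumFin (λ j → c j * M i j) ≈ + 0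
  row-sum≈0 c rel i = mk≈ (rel i)

  relation-cong : ∀ {c d} → (∀ j → c j ≈ d j) → IsRelation p M c → IsRelation p M d
  relation-cong {c} c≈d rel i =
    p∣x-y (≈-trans (sumFin-cong λ j → *-congʳ _ (≈-sym (c≈d j))) (row-sum≈0 c rel i))

  relation-combination : ∀ {u v} x y → IsRelation p M u → IsRelation p M v →
                         IsRelation p M (λ j → x * u j - y * v j)
  relation-combination {u} {v} x y relu relv i = p∣x-y (begin
      sumFin (λ j → (x * u j - y * v j) * M i j)
    ≈⟨ sumFin-cong (λ j → ≈-reflexive (distribute x y (u j) (v j) (M i j))) ⟩
      sumFin (λ j → x * (u j * M i j) + (- y) * (v j * M i j))
    ≡⟨ sumFin-+ (λ j → x * (u j * M i j)) (λ j → (- y) * (v j * M i j)) ⟩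
      sumFin (λ j → x * (u j * M i j)) + sumFin (λ j → (- y) * (v j * M i j))
    ≡⟨ cong₂ _+_ (sumFin-*ˡ x (λ j → u j * M i j)) (sumFin-*ˡ (- y) (λ j → v j * M i j)) ⟩
      x * sumFin (λ j → u j * M i j) + (- y) * sumFin (λ j → v j * M i j)
    ≈⟨ +-cong (≈0-* x (row-sum≈0 u relu i)) (≈0-* (- y) (row-sum≈0 v relv i)) ⟩
      + 0 ∎)
    where
    open ≈-Reasoning
    distribute : ∀ x y u v a → (x * u - y * v) * a ≡ x * (u * a) + (- y) * (v * a)
    distribute = solve-∀

  -- (+ 0 * x reduces to + 0.)
  zero-relation : IsRelation p M (λ _ → + 0)
  zero-relation i = p∣x-y (≈-reflexive (sumFin-*ˡ (+ 0) (M i)))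

  dependent : ∀ {c S j} → IsRelation p M c → Supported c S → j ∈ S → ¬ (c j ≈ + 0) → Dependent p M S
  dependent {c} {j = j} rel supp j∈S cj≉0 =
    c , rel , (λ i i∉S → p∣x-y (supp i i∉S)) , j , j∈S , (cj≉0 ∘ mk≈)

  Rigid : Subset n → Set
  Rigid C = ∀ c → IsRelation p M c → Supported c C → ∀ {j} → j ∈ C → c j ≈ + 0 → ∀ k → c k ≈ + 0

  circuit⇒rigid : ∀ {C} → Circuit p M C → Rigid C
  circuit⇒rigid {C} (_ , minimal) c rel supp {j} j∈C cj≈0 k with c k ≈? + 0
  ... | yes ck≈0 = ck≈0
  ... | no ck≉0 = ⊥-elim (minimal (C ─ ⁅ j ⁆) (x∈p⇒p-x⊂p j∈C) (dependent rel supp′ k∈C-j ck≉0))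
    where
    supp′ : Supported c (C ─ ⁅ j ⁆)
    supp′ i i∉C-j with i ≟ᶠ j
    ... | yes refl = cj≈0
    ... | no i≢j = supp i (λ i∈C → i∉C-j (x∈p∧x≢y⇒x∈p-y i∈C i≢j))
    k∈C-j : k ∈ C ─ ⁅ j ⁆
    k∈C-j = x∈p∧x≢y⇒x∈p-y (supported⇒∈ supp ck≉0) (λ { refl → ck≉0 cj≈0 })

  rigid⇒circuit : ∀ {C} → Dependent p M C → Rigid C → Circuit p M C
  rigid⇒circuit dep rigid = dep , λ where
    D (D⊆C , k , k∈C , k∉D) (d , rel , supp , j , j∈D , dj≉0) →
      dj≉0 (p∣x-y (rigid d rel (λ i i∉C → mk≈ (supp i (i∉C ∘ D⊆C))) k∈C (mk≈ (supp k k∉D)) j))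

  Coefficients : Subset n → (Fin n → ℤ) → Set
  Coefficients C c = IsRelation p M c × Supported c C × (∀ {j} → j ∈ C → ¬ (c j ≈ + 0))

  coefficients⇒CircuitCoeffs : ∀ {C c} → Coefficients C c → CircuitCoeffs p M C c
  coefficients⇒CircuitCoeffs (rel , supp , nonzero) =
    rel , λ j → (λ j∈C → nonzero j∈C ∘ mk≈) , (λ j∉C → p∣x-y (supp j j∉C))

  CircuitCoeffs⇒coefficients : ∀ {C c} → CircuitCoeffs p M C c → Coefficients C c
  CircuitCoeffs⇒coefficients (rel , support) =
    rel , (λ j j∉C → mk≈ (proj₂ (support j) j∉C)) , λ {j} j∈C cj≈0 → proj₁ (support j) j∈C (p∣x-y cj≈0)

  circuit-coefficients : ∀ {C} → Circuit p M C → Σ (Fin n → ℤ) (Coefficients C)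
  circuit-coefficients circuit@((c , rel , supp , j , _ , cj≉0) , _) =
    c , rel , supp′ , λ k∈C ck≈0 → cj≉0 (p∣x-y (circuit⇒rigid circuit c rel supp′ k∈C ck≈0 j))
    where
    supp′ : Supported c _
    supp′ i i∉C = mk≈ (supp i i∉C)

  circuit-proportional : ∀ {C c d} → Circuit p M C →
                         IsRelation p M c → Supported c C → IsRelation p M d → Supported d C →
                         ∀ {j} → j ∈ C → ∀ k → c j * d k ≈ d j * c k
  circuit-proportional {c = c} {d} circuit relc suppc reld suppd {j} j∈C k =
    -≈0⇒≈ (circuit⇒rigid circuit g (relation-combination (c j) (d j) reld relc) suppg j∈C gj≈0 k)
    where
    g : Fin n → ℤ
    g i = c j * d i - d j * c i
    suppg : Supported g _
    suppg i i∉C = +-cong (≈0-* (c j) (suppd i i∉C)) (-‿cong (≈0-* (d j) (suppc i i∉C)))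
    gj≈0 : g j ≈ + 0
    gj≈0 = ≈-reflexive (antisymmetric (c j) (d j))
      where
      antisymmetric : ∀ x y → x * y - y * x ≡ + 0
      antisymmetric = solve-∀

  circuit-functional-≈0 : ∀ {C c d} → Prime p → Circuit p M C → Coefficients C c →
                         IsRelation p M d → Supported d C → ∀ {a b} → ¬ (c a + c b ≈ + 0) → d a + d b ≈ + 0 →
                         ∀ k → d k ≈ + 0
  circuit-functional-≈0 {C} {c} {d} p-prime circuit (relc , suppc , _) reld suppd {a} {b} cab≉0 dab≈0 k
    with k ∈? C
  ... | no k∉C = suppd k k∉C
  ... | yes k∈C = [ id , ⊥-elim ∘ cab≉0 ]′ (*≈0⇒≈0⊎≈0 p-prime (d k) (c a + c b) dk[cab]≈0)
    where
    proportional = circuit-proportional circuit relc suppc reld suppd k∈C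
    dk[cab]≈0 : d k * (c a + c b) ≈ + 0
    dk[cab]≈0 = begin
        d k * (c a + c b)
      ≈⟨ ≈-reflexive (*-distribˡ-+ (d k) (c a) (c b)) ⟩
        d k * c a + d k * c b
      ≈⟨ ≈-sym (+-cong (proportional a) (proportional b)) ⟩
        c k * d a + c k * d b
      ≈⟨ ≈-reflexive (sym (*-distribˡ-+ (c k) (d a) (d b))) ⟩
        c k * (d a + d b)
      ≈⟨ ≈0-* (c k) dab≈0 ⟩
        + 0 ∎
      where open ≈-Reasoning

module Splitting (p : ℕ) (p-prime : Prime p) {m n : ℕ} (A : Matrix m n)
                 (a b : Fin n) (a≢b : ¬ a ≡ b) (α : ℤ) (α≉0 : ¬ (α ≡ + 0 [mod p ])) where
  open Congruence p
  module RA = Relations p A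

  B : Matrix (suc m) (suc (suc n))
  B = Ae A a b α b

  module RB = Relations p B

  pattern γ = zero
  pattern z = suc zero
  pattern ι j = suc (suc j)

  ground : Subset (suc (suc n)) → Subset n
  ground (_ ∷ _ ∷ S) = S

  ι∈ : ∀ {D j} → j ∈ ground D → ι j ∈ D
  ι∈ {_ ∷ _ ∷ _} = there ∘ there

  ι∈⁻ : ∀ {D j} → ι j ∈ D → j ∈ ground D
  ι∈⁻ {_ ∷ _ ∷ _} = drop-there ∘ drop-there

  project : (Fin (suc (suc n)) → ℤ) → Fin n → ℤ
  project d j = d (ι j) + δ b (d γ) j

  Balanced : (Fin (suc (suc n)) → ℤ) → Set
  Balanced d = d z + (d (ι a) + d (ι b)) ≈ + 0

  by-cases-on-b : ∀ {ℓ} {P : Fin n → Set ℓ} → P b → (∀ {j} → ¬ j ≡ b → P j) → ∀ j → P j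
  by-cases-on-b {P = P} Pb P≢b j with j ≟ᶠ b
  ... | yes j≡b = subst P (sym j≡b) Pb
  ... | no j≢b = P≢b j≢b

  private
    pair-indicator : ∀ j → (if does (j ≟ᶠ a) ∨ does (j ≟ᶠ b) then α else + 0) ≡ δ a α j + δ b α j
    pair-indicator j with j ≟ᶠ a | j ≟ᶠ b
    ... | yes refl | yes refl = ⊥-elim (a≢b refl)
    ... | yes _    | no _     = sym (+-identityʳ α)
    ... | no _     | yes _    = sym (+-identityˡ α)
    ... | no _     | no _     = refl

    γ-entry : B zero γ ≡ + 0
    γ-entry = begin
        (if does (b ≟ᶠ a) ∨ does (b ≟ᶠ b) then α else + 0) - α
      ≡⟨ cong (_- α) (pair-indicator b) ⟩
        δ a α b + δ b α b - α
      ≡⟨ cong₂ (λ u v → u + v - α) (δ-other α (a≢b ∘ sym)) (δ-self b α) ⟩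
        + 0 + α - α
      ≡⟨ cancel α ⟩
        + 0 ∎
      where
      open ≡-Reasoning
      cancel : ∀ x → + 0 + x - x ≡ + 0
      cancel = solve-∀

  row₀ : ∀ d → sumFin (λ k → d k * B zero k) ≈ (d z + (d (ι a) + d (ι b))) * α
  row₀ d = begin
      d γ * B zero γ + (d z * α + sumFin (λ j → d (ι j) * B zero (ι j)))
    ≈⟨ +-cong (≈-reflexive (cong (d γ *_) γ-entry)) (+-congˡ (d z * α) (sumFin-cong (≈-reflexive ∘ split))) ⟩
      d γ * + 0 + (d z * α + sumFin (λ j → d (ι j) * δ a α j + d (ι j) * δ b α j))
    ≡⟨ cong (λ s → d γ * + 0 + (d z * α + s)) sum-split ⟩
      d γ * + 0 + (d z * α + (d (ι a) * α + d (ι b) * α))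
    ≡⟨ collect (d γ) (d z) (d (ι a)) (d (ι b)) α ⟩
      (d z + (d (ι a) + d (ι b))) * α ∎
    where
    open ≈-Reasoning
    split : ∀ j → d (ι j) * B zero (ι j) ≡ d (ι j) * δ a α j + d (ι j) * δ b α j
    split j = trans (cong (d (ι j) *_) (pair-indicator j)) (*-distribˡ-+ (d (ι j)) (δ a α j) (δ b α j))
    sum-split : sumFin (λ j → d (ι j) * δ a α j + d (ι j) * δ b α j) ≡ d (ι a) * α + d (ι b) * α
    sum-split = trans (sumFin-+ (λ j → d (ι j) * δ a α j) (λ j → d (ι j) * δ b α j))
                      (cong₂ _+_ (sumFin-δ a α (d ∘ ι)) (sumFin-δ b α (d ∘ ι)))
    collect : ∀ g u x y α → g * + 0 + (u * α + (x * α + y * α)) ≡ (u + (x + y)) * α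
    collect = solve-∀

  rowₛ : ∀ d i → sumFin (λ k → d k * B (suc i) k) ≈ sumFin (λ j → project d j * A i j)
  rowₛ d i = begin
      d γ * (A i b - + 0) + (d z * + 0 + sumFin (λ j → d (ι j) * A i j))
    ≡⟨ collect (d γ) (d z) (A i b) (sumFin (λ j → d (ι j) * A i j)) ⟩
      sumFin (λ j → d (ι j) * A i j) + A i b * d γ
    ≡⟨ sum-merge ⟨
      sumFin (λ j → d (ι j) * A i j + A i j * δ b (d γ) j)
    ≈⟨ sumFin-cong (λ j → ≈-reflexive (distribute (d (ι j)) (δ b (d γ) j) (A i j))) ⟩
      sumFin (λ j → project d j * A i j) ∎
    where
    open ≈-Reasoning
    sum-merge : sumFin (λ j → d (ι j) * A i j + A i j * δ b (d γ) j) ≡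
                sumFin (λ j → d (ι j) * A i j) + A i b * d γ
    sum-merge = trans (sumFin-+ (λ j → d (ι j) * A i j) (λ j → A i j * δ b (d γ) j))
                      (cong (_+_ (sumFin (λ j → d (ι j) * A i j))) (sumFin-δ b (d γ) (A i)))
    collect : ∀ g u x s → g * (x - + 0) + (u * + 0 + s) ≡ s + x * g
    collect = solve-∀
    distribute : ∀ x y u → x * u + u * y ≡ (x + y) * u
    distribute = solve-∀

  relation⇒balanced : ∀ d → IsRelation p B d → Balanced d
  relation⇒balanced d rel
    with *≈0⇒≈0⊎≈0 p-prime _ α (≈-trans (≈-sym (row₀ d)) (RB.row-sum≈0 d rel zero))
  ... | inj₁ balanced = balanced
  ... | inj₂ α≈0 = ⊥-elim (α≉0 (p∣x-y α≈0))

  relation⇒project : ∀ d → IsRelation p B d → IsRelation p A (project d)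
  relation⇒project d rel i = p∣x-y (≈-trans (≈-sym (rowₛ d i)) (RB.row-sum≈0 d rel (suc i)))

  relation⇐ : ∀ d → Balanced d → IsRelation p A (project d) → IsRelation p B d
  relation⇐ d balanced rel zero = p∣x-y (≈-trans (row₀ d) (*-congʳ α balanced))
  relation⇐ d balanced rel (suc i) = p∣x-y (≈-trans (rowₛ d i) (RA.row-sum≈0 (project d) rel i))

  project-b : ∀ d → project d b ≡ d (ι b) + d γ
  project-b d = cong (_+_ (d (ι b))) (δ-self b (d γ))

  project-≢b : ∀ d {j} → ¬ j ≡ b → project d j ≡ d (ι j)
  project-≢b d {j} j≢b = trans (cong (_+_ (d (ι j))) (δ-other (d γ) j≢b)) (+-identityʳ (d (ι j)))

  project-≈ : ∀ d → d γ ≈ + 0 → ∀ j → project d j ≈ d (ι j)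
  project-≈ d dγ≈0 j = ≈-trans (+-congˡ (d (ι j)) (δ≈0 j)) (≈-reflexive (+-identityʳ (d (ι j))))
    where
    δ≈0 : ∀ j → δ b (d γ) j ≈ + 0
    δ≈0 j with j ≟ᶠ b
    ... | yes _ = dγ≈0
    ... | no _ = ≈-refl

  project-null : ∀ d → (∀ k → d k ≈ + 0) → ∀ j → project d j ≈ + 0
  project-null d d≈0 j = ≈-trans (project-≈ d (d≈0 γ) j) (d≈0 (ι j))

  null-projection : ∀ d → IsRelation p B d → (∀ j → project d j ≈ + 0) → d γ ≈ + 0 → ∀ k → d k ≈ + 0
  null-projection d rel project≈0 dγ≈0 = vanish
    where
    dι≈0 : ∀ j → d (ι j) ≈ + 0
    dι≈0 j = ≈-trans (≈-sym (project-≈ d dγ≈0 j)) (project≈0 j)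
    vanish : ∀ k → d k ≈ + 0
    vanish γ = dγ≈0
    vanish z = +≈0⇒≈0ˡ (relation⇒balanced d rel) (+-cong (dι≈0 a) (dι≈0 b))
    vanish (ι j) = dι≈0 j

  embed : (Fin n → ℤ) → Fin (suc (suc n)) → ℤ
  embed c γ = + 0
  embed c z = - (c a + c b)
  embed c (ι j) = c j

  embed-relation : ∀ c → IsRelation p A c → IsRelation p B (embed c)
  embed-relation c rel =
    relation⇐ (embed c) (≈-reflexive (+-inverseˡ (c a + c b)))
      (RA.relation-cong (λ j → ≈-sym (project-≈ (embed c) ≈-refl j)) rel)

  embedγ : (Fin n → ℤ) → Fin (suc (suc n)) → ℤ
  embedγ c γ = c b
  embedγ c z = + 0
  embedγ c (ι j) = c j - δ b (c b) j

  project-embedγ : ∀ c j → project (embedγ c) j ≡ c j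
  project-embedγ c j = cancel (c j) (δ b (c b) j)
    where
    cancel : ∀ x y → x - y + y ≡ x
    cancel = solve-∀

  embedγ-b : ∀ c → embedγ c (ι b) ≡ + 0
  embedγ-b c = trans (cong (_-_ (c b)) (δ-self b (c b))) (+-inverseʳ (c b))

  embedγ-≢b : ∀ c {j} → ¬ j ≡ b → embedγ c (ι j) ≡ c j
  embedγ-≢b c {j} j≢b = trans (cong (_-_ (c j)) (δ-other (c b) j≢b)) (+-identityʳ (c j))

  embedγ-relation : ∀ c → IsRelation p A c → c a ≈ + 0 → IsRelation p B (embedγ c)
  embedγ-relation c rel ca≈0 =
    relation⇐ (embedγ c) balanced (RA.relation-cong (λ j → ≈-reflexive (sym (project-embedγ c j))) rel)
    where
    balanced : Balanced (embedγ c)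
    balanced = ≈-trans (≈-reflexive (begin
        + 0 + (c a - δ b (c b) a + (c b - δ b (c b) b))
      ≡⟨ cong₂ (λ u v → + 0 + (c a - u + (c b - v))) (δ-other (c b) a≢b) (δ-self b (c b)) ⟩
        + 0 + (c a - + 0 + (c b - c b))
      ≡⟨ simplify (c a) (c b) ⟩
        c a ∎)) ca≈0
      where
      open ≡-Reasoning
      simplify : ∀ x y → + 0 + (x - + 0 + (y - y)) ≡ x
      simplify = solve-∀

  project-supported : ∀ {d r C} → Supported d (outside ∷ r ∷ C) → Supported (project d) C
  project-supported {d} supp j j∉C = ≈-trans (project-≈ d (supp γ λ ()) j) (supp (ι j) (j∉C ∘ ι∈⁻))

  project-rigid : ∀ {d r C} → Circuit p A C → IsRelation p B d → Supported d (outside ∷ r ∷ C) →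
                  ∀ {j} → j ∈ C → d (ι j) ≈ + 0 → ∀ k → d k ≈ + 0
  project-rigid {d} circuit rel supp {j} j∈C dιj≈0 = null-projection d rel
    (RA.circuit⇒rigid circuit (project d) (relation⇒project d rel) (project-supported supp) j∈C
      (≈-trans (project-≈ d dγ≈0 j) dιj≈0))
    dγ≈0
    where
    dγ≈0 = supp γ λ ()

  z-circuit : ∀ {C c} → Circuit p A C → RA.Coefficients C c → ¬ (c a + c b ≈ + 0) →
              Circuit p B (outside ∷ inside ∷ C)
  z-circuit {C} {c} circuit coeffs@(rel , supp , _) cab≉0 =
    RB.rigid⇒circuit (RB.dependent (embed-relation c rel) embed-supported (there here) (cab≉0 ∘ -≈0⇒≈0)) rigid
    where
    embed-supported : Supported (embed c) (outside ∷ inside ∷ C)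
    embed-supported γ _ = ≈-refl
    embed-supported z z∉ = ⊥-elim (z∉ (there here))
    embed-supported (ι j) ιj∉ = supp j (ιj∉ ∘ ι∈)
    rigid : RB.Rigid (outside ∷ inside ∷ C)
    rigid d rel supp (there here) dz≈0 = null-projection d rel
      (RA.circuit-functional-≈0 p-prime circuit coeffs (relation⇒project d rel) (project-supported supp) cab≉0
        (≈-trans (+-cong (project-≈ d dγ≈0 a) (project-≈ d dγ≈0 b)) (+≈0⇒≈0ʳ (relation⇒balanced d rel) dz≈0)))
      dγ≈0
      where
      dγ≈0 = supp γ λ ()
    rigid d rel supp (there (there j∈C)) = project-rigid circuit rel supp j∈C

  plain-circuit : ∀ {C} → Circuit p A C → a ∉ C → b ∉ C → Circuit p B (outside ∷ outside ∷ C)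
  plain-circuit {C} circuit@((_ , _ , _ , j , j∈C , _) , _) a∉C b∉C =
    let c , rel , supp , nonzero = RA.circuit-coefficients circuit
        embed-supported : Supported (embed c) (outside ∷ outside ∷ C)
        embed-supported = λ where
          γ _ → ≈-refl
          z _ → -‿cong (+-cong (supp a a∉C) (supp b b∉C))
          (ι i) ιi∉ → supp i (ιi∉ ∘ ι∈)
    in RB.rigid⇒circuit (RB.dependent (embed-relation c rel) embed-supported (ι∈ j∈C) (nonzero j∈C)) rigid
    where
    rigid : RB.Rigid (outside ∷ outside ∷ C)
    rigid d rel supp (there (there j∈C)) = project-rigid circuit rel supp j∈C

  γ-circuit : ∀ {C} → Circuit p A C → b ∈ C → a ∉ C → Circuit p B (inside ∷ outside ∷ (C ─ ⁅ b ⁆))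
  γ-circuit {C} circuit b∈C a∉C =
    let c , rel , supp , nonzero = RA.circuit-coefficients circuit
    in RB.rigid⇒circuit
         (RB.dependent (embedγ-relation c rel (supp a a∉C)) (embedγ-supported supp) here (nonzero b∈C))
         rigid
    where
    D = inside ∷ outside ∷ (C ─ ⁅ b ⁆)
    embedγ-supported : ∀ {c} → Supported c C → Supported (embedγ c) D
    embedγ-supported supp γ γ∉D = ⊥-elim (γ∉D here)
    embedγ-supported supp z _ = ≈-refl
    embedγ-supported {c} supp (ι j) ιj∉D = by-cases-on-b {P = λ j → ι j ∉ D → embedγ c (ι j) ≈ + 0}
      (λ _ → ≈-reflexive (embedγ-b c))
      (λ j≢b ιj∉D → ≈-trans (≈-reflexive (embedγ-≢b c j≢b))
                            (supp _ (λ j∈C → ιj∉D (ι∈ (x∈p∧x≢y⇒x∈p-y j∈C j≢b)))))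
      j ιj∉D
    rigid : RB.Rigid D
    rigid d rel supp {k} k∈D dk≈0 = null-projection d rel project≈0 dγ≈0
      where
      dιb≈0 : d (ι b) ≈ + 0
      dιb≈0 = supp (ι b) (x∉p─⁅x⁆ b ∘ ι∈⁻)
      project-supported′ : Supported (project d) C
      project-supported′ j j∉C = ≈-trans (≈-reflexive (project-≢b d (λ { refl → j∉C b∈C })))
                                         (supp (ι j) (j∉C ∘ p─q⊆p C ⁅ b ⁆ ∘ ι∈⁻))
      vanishing-point : ∀ {k} → k ∈ D → d k ≈ + 0 → Σ (Fin n) λ j → j ∈ C × project d j ≈ + 0
      vanishing-point here dγ≈0 = b , b∈C , ≈-trans (≈-reflexive (project-b d)) (+-cong dιb≈0 dγ≈0)
      vanishing-point (there (there j∈C-b)) dιj≈0 = _ , p─q⊆p C ⁅ b ⁆ j∈C-b ,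
        ≈-trans (≈-reflexive (project-≢b d (λ { refl → x∉p─⁅x⁆ b j∈C-b }))) dιj≈0
      project≈0 : ∀ j → project d j ≈ + 0
      project≈0 = let j , j∈C , projectj≈0 = vanishing-point k∈D dk≈0 in
        RA.circuit⇒rigid circuit (project d) (relation⇒project d rel) project-supported′ j∈C projectj≈0
      dγ≈0 : d γ ≈ + 0
      dγ≈0 = +≈0⇒≈0ʳ (≈-trans (≈-reflexive (sym (project-b d))) (project≈0 b)) dιb≈0

  γ-circuit⁻¹ : ∀ {T} → Circuit p B (inside ∷ outside ∷ T) → a ∉ T → b ∉ T → Circuit p A (T ∪ ⁅ b ⁆)
  γ-circuit⁻¹ {T} circuit a∉T b∉T =
    let e , rel , supp , nonzero = RB.circuit-coefficients circuit
        eιb≈0 = supp (ι b) (b∉T ∘ ι∈⁻)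
        project-supported′ : Supported (project e) (T ∪ ⁅ b ⁆)
        project-supported′ j j∉T∪b = ≈-trans (≈-reflexive (project-≢b e (j∉T∪b ∘ ∈⁅b⁆)))
                                             (supp (ι j) (j∉T∪b ∘ ∈T ∘ ι∈⁻))
    in RA.rigid⇒circuit
         (RA.dependent (relation⇒project e rel) project-supported′ (∈⁅b⁆ refl)
           (λ projectb≈0 → nonzero here (+≈0⇒≈0ʳ (≈-trans (≈-reflexive (sym (project-b e))) projectb≈0) eιb≈0)))
         rigid
    where
    ∈T : ∀ {j} → j ∈ T → j ∈ T ∪ ⁅ b ⁆
    ∈T j∈T = x∈p∪q⁺ (inj₁ j∈T)
    ∈⁅b⁆ : ∀ {j} → j ≡ b → j ∈ T ∪ ⁅ b ⁆
    ∈⁅b⁆ refl = x∈p∪q⁺ (inj₂ (x∈⁅x⁆ b))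
    rigid : RA.Rigid (T ∪ ⁅ b ⁆)
    rigid d rel supp {j} j∈T∪b dj≈0 i =
      ≈-trans (≈-reflexive (sym (project-embedγ d i))) (project-null (embedγ d) embedγ≈0 i)
      where
      D = inside ∷ outside ∷ T
      embedγ-supported : Supported (embedγ d) D
      embedγ-supported γ γ∉D = ⊥-elim (γ∉D here)
      embedγ-supported z _ = ≈-refl
      embedγ-supported (ι j) ιj∉D = by-cases-on-b {P = λ j → ι j ∉ D → embedγ d (ι j) ≈ + 0}
        (λ _ → ≈-reflexive (embedγ-b d))
        (λ j≢b ιj∉D → ≈-trans (≈-reflexive (embedγ-≢b d j≢b))
                              (supp _ (λ j∈T∪b → [ ιj∉D ∘ ι∈ , j≢b ∘ x∈⁅y⁆⇒x≡y b ]′ (x∈p∪q⁻ T ⁅ b ⁆ j∈T∪b))))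
        j ιj∉D
      da≈0 = supp a (λ a∈T∪b → [ a∉T , a≢b ∘ x∈⁅y⁆⇒x≡y b ]′ (x∈p∪q⁻ T ⁅ b ⁆ a∈T∪b))
      vanish = RB.circuit⇒rigid circuit (embedγ d) (embedγ-relation d rel da≈0) embedγ-supported
      embedγ≈0 : ∀ k → embedγ d k ≈ + 0
      embedγ≈0 with x∈p∪q⁻ T ⁅ b ⁆ j∈T∪b
      ... | inj₁ j∈T = vanish (ι∈ j∈T) (≈-trans (≈-reflexive (embedγ-≢b d λ { refl → b∉T j∈T })) dj≈0)
      ... | inj₂ j∈b = vanish here (≈-trans (≈-reflexive (cong d (sym (x∈⁅y⁆⇒x≡y b j∈b)))) dj≈0)

  plain-or-z-circuit⁻¹ : ∀ {r S} → Circuit p B (outside ∷ r ∷ S) → (z ∉ outside ∷ r ∷ S → a ∉ S × b ∉ S) →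
                         Circuit p A S
  plain-or-z-circuit⁻¹ {r} {S} circuit@((_ , _ , _ , k , k∈D , _) , _) z∉⇒a,b∉ =
    let e , rel , supp , nonzero = RB.circuit-coefficients circuit
        project≈ι = project-≈ e (supp γ λ ())
        nonzero-point : ∀ k → k ∈ outside ∷ r ∷ S → Σ (Fin n) λ j → ¬ (project e j ≈ + 0)
        nonzero-point = λ where
          z (there here) → [ (λ ea≉0 → a , ea≉0 ∘ ≈-trans (≈-sym (project≈ι a)))
                         , (λ eb≉0 → b , eb≉0 ∘ ≈-trans (≈-sym (project≈ι b))) ]′
                         (+≉0⇒≉0⊎≉0 (e (ι a)) (e (ι b))
                           (nonzero (there here) ∘ +≈0⇒≈0ˡ (relation⇒balanced e rel)))
          (ι j) (there (there j∈S)) → j , nonzero (ι∈ j∈S) ∘ ≈-trans (≈-sym (project≈ι j))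
        j , projectj≉0 = nonzero-point k k∈D
    in RA.rigid⇒circuit
         (RA.dependent (relation⇒project e rel) (project-supported supp)
                       (supported⇒∈ (project-supported supp) projectj≉0) projectj≉0)
         rigid
    where
    rigid : RA.Rigid S
    rigid d rel supp j∈S dj≈0 i =
      RB.circuit⇒rigid circuit (embed d) (embed-relation d rel) embed-supported (ι∈ j∈S) dj≈0 (ι i)
      where
      embed-supported : Supported (embed d) (outside ∷ r ∷ S)
      embed-supported γ _ = ≈-refl
      embed-supported z z∉D = let a∉S , b∉S = z∉⇒a,b∉ z∉D in -‿cong (+-cong (supp a a∉S) (supp b b∉S))
      embed-supported (ι i) ιi∉D = supp i (ιi∉D ∘ ι∈)

  z-circuit⁻¹-coefficients : ∀ {S} → Circuit p B (outside ∷ inside ∷ S) →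
                             Σ (Fin n → ℤ) λ c → RA.Coefficients S c × ¬ (c a + c b ≈ + 0)
  z-circuit⁻¹-coefficients {S} circuit =
    let e , rel , supp , nonzero = RB.circuit-coefficients circuit
        project≈ι = project-≈ e (supp γ λ ())
    in project e ,
       (relation⇒project e rel , project-supported supp ,
        λ j∈S → nonzero (ι∈ j∈S) ∘ ≈-trans (≈-sym (project≈ι _))) ,
       λ cab≈0 → nonzero (there here)
         (+≈0⇒≈0ˡ (relation⇒balanced e rel) (≈-trans (≈-sym (+-cong (project≈ι a) (project≈ι b))) cab≈0))

  z-free-circuit-ιa⇒ιb : ∀ {D} → Circuit p B D → z ∉ D → ι a ∈ D → ι b ∈ D
  z-free-circuit-ιa⇒ιb circuit z∉D ιa∈D =
    let e , rel , supp , nonzero = RB.circuit-coefficients circuit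
    in supported⇒∈ supp (nonzero ιa∈D ∘ +≈0⇒≈0ˡ (+≈0⇒≈0ʳ (relation⇒balanced e rel) (supp z z∉D)))

  z-free-circuit-ιb⇒ιa : ∀ {D} → Circuit p B D → z ∉ D → ι b ∈ D → ι a ∈ D
  z-free-circuit-ιb⇒ιa circuit z∉D ιb∈D =
    let e , rel , supp , nonzero = RB.circuit-coefficients circuit
    in supported⇒∈ supp (nonzero ιb∈D ∘ +≈0⇒≈0ʳ (+≈0⇒≈0ʳ (relation⇒balanced e rel) (supp z z∉D)))

  triangle : Fin (suc (suc n)) → ℤ
  triangle γ = + 1
  triangle z = + 1
  triangle (ι j) = - δ b (+ 1) j

  triangle-relation : IsRelation p B triangle
  triangle-relation = relation⇐ triangle balanced
    (RA.relation-cong (λ j → ≈-reflexive (sym (+-inverseˡ (δ b (+ 1) j)))) RA.zero-relation)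
    where
    balanced : Balanced triangle
    balanced = ≈-reflexive (cong₂ (λ u v → + 1 + (- u + - v)) (δ-other (+ 1) a≢b) (δ-self b (+ 1)))

  CircuitCollection : Set
  CircuitCollection =
    Σ (Subset n) λ Cnp → Σ (Subset n) λ C₁ → Σ (List (Subset n)) λ Cs →
      NPCircuit p A a b Cnp × a ∈ Cnp × b ∈ Cnp ×
      Circuit p A C₁ × All (Circuit p A) Cs ×
      (∀ j → j ∈ Cnp ⊎ j ∈ C₁ ⊎ Any (j ∈_) Cs) ×
      b ∈ C₁ × (∀ j → j ∈ Cnp → j ∈ C₁ → j ≡ b) ×
      All (Disjoint Cnp) Cs × All (Disjoint C₁) Cs × AllPairs Disjoint Cs

  module EulerianDecomposition (Ds : List (Subset (suc (suc n)))) (circuits : All (Circuit p B) Ds)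
                               (disjoint : AllPairs Disjoint Ds) (covering : ∀ k → Any (k ∈_) Ds) where

    circuit : ∀ {D} → D ∈ₗ Ds → Circuit p B D
    circuit = All.lookup circuits

    ∈-transfer : ∀ {D D′ k x} → D ∈ₗ Ds → D′ ∈ₗ Ds → k ∈ D → k ∈ D′ → x ∈ D → x ∈ D′
    ∈-transfer D∈ D′∈ k∈D k∈D′ = subst (_ ∈_) (meeting⇒≡ disjoint D∈ D′∈ k∈D k∈D′)

    separated : ∀ {D D′ k} → D ∈ₗ Ds → D′ ∈ₗ Ds → k ∈ D → k ∉ D′ → Disjoint D D′
    separated D∈ D′∈ k∈D k∉D′ j j∈D j∈D′ = k∉D′ (∈-transfer D∈ D′∈ j∈D j∈D′ k∈D)

    closed : ∀ {x y} → (∀ {D} → Circuit p B D → z ∉ D → x ∈ D → y ∈ D) →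
                        (∀ {D} → Circuit p B D → z ∉ D → y ∈ D → x ∈ D) →
                        ∀ {D} → D ∈ₗ Ds → x ∈ D → y ∈ D
    closed {y = y} x⇒y y⇒x {D} D∈ x∈D with z ∈? D | find (covering y)
    ... | no z∉D | _ = x⇒y (circuit D∈) z∉D x∈D
    ... | yes z∈D | D′ , D′∈ , y∈D′ with z ∈? D′
    ...   | yes z∈D′ = ∈-transfer D′∈ D∈ z∈D′ z∈D y∈D′
    ...   | no z∉D′ = ∈-transfer D′∈ D∈ (y⇒x (circuit D′∈) z∉D′ y∈D′) x∈D y∈D′

    ιa∈⇒ιb∈ : ∀ {D} → D ∈ₗ Ds → ι a ∈ D → ι b ∈ D
    ιa∈⇒ιb∈ = closed z-free-circuit-ιa⇒ιb z-free-circuit-ιb⇒ιa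

    ιb∈⇒ιa∈ : ∀ {D} → D ∈ₗ Ds → ι b ∈ D → ι a ∈ D
    ιb∈⇒ιa∈ = closed z-free-circuit-ιb⇒ιa z-free-circuit-ιa⇒ιb

    γz-apart : ∀ {D} → D ∈ₗ Ds → γ ∈ D → z ∉ D
    γz-apart {D} D∈ γ∈D z∈D with ι a ∈? D
    ... | yes ιa∈D = 1≉0 p-prime
          (RB.circuit⇒rigid (circuit D∈) triangle triangle-relation triangle-supported ιa∈D
            (≈-reflexive (cong -_ (δ-other (+ 1) a≢b))) γ)
      where
      triangle-supported : Supported triangle D
      triangle-supported γ γ∉D = ⊥-elim (γ∉D γ∈D)
      triangle-supported z z∉D = ⊥-elim (z∉D z∈D)
      triangle-supported (ι j) = by-cases-on-b {P = λ j → ι j ∉ D → triangle (ι j) ≈ + 0}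
        (λ ιb∉D → ⊥-elim (ιb∉D (ιa∈⇒ιb∈ D∈ ιa∈D)))
        (λ j≢b _ → ≈-reflexive (cong -_ (δ-other (+ 1) j≢b)))
        j
    ... | no ιa∉D =
      let e , rel , supp , nonzero = RB.circuit-coefficients (circuit D∈)
      in nonzero z∈D (+≈0⇒≈0ˡ (relation⇒balanced e rel)
           (+-cong (supp (ι a) ιa∉D) (supp (ι b) (ιa∉D ∘ ιb∈⇒ιa∈ D∈))))

    γz-free? : (D : Subset (suc (suc n))) → Dec (γ ∉ D × z ∉ D)
    γz-free? D = ¬? (γ ∈? D) ×-dec ¬? (z ∈? D)

    Rest : List (Subset (suc (suc n)))
    Rest = filter γz-free? Ds

    all-rest : ∀ {P : Subset (suc (suc n)) → Set} → (∀ {D} → D ∈ₗ Ds → γ ∉ D → z ∉ D → P D) → All P Rest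
    all-rest P-rest = All.tabulate λ D∈ →
      let D∈Ds , γ∉D , z∉D = ∈-filter⁻ γz-free? {xs = Ds} D∈ in P-rest D∈Ds γ∉D z∉D

    ground-disjoint : ∀ {D D′} → Disjoint D D′ → Disjoint (ground D) (ground D′)
    ground-disjoint D#D′ j j∈D j∈D′ = D#D′ (ι j) (ι∈ j∈D) (ι∈ j∈D′)

    module _ {S T} (Dz∈ : (outside ∷ inside ∷ S) ∈ₗ Ds) (Dγ∈ : (inside ∷ outside ∷ T) ∈ₗ Ds) where

      Dz#Dγ : Disjoint (outside ∷ inside ∷ S) (inside ∷ outside ∷ T)
      Dz#Dγ = separated Dz∈ Dγ∈ (there here) (λ { (there ()) })

      np = z-circuit⁻¹-coefficients (circuit Dz∈)

      a∈S : a ∈ S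
      a∈S = let c , (_ , supp , _) , cab≉0 = np in
        [ (λ ca≉0 → supported⇒∈ supp ca≉0) , (λ cb≉0 → ι∈⁻ (ιb∈⇒ιa∈ Dz∈ (ι∈ (supported⇒∈ supp cb≉0)))) ]′
        (+≉0⇒≉0⊎≉0 _ _ cab≉0)

      b∈S : b ∈ S
      b∈S = ι∈⁻ (ιa∈⇒ιb∈ Dz∈ (ι∈ a∈S))

      S#T : ∀ {j} → j ∈ S → j ∉ T
      S#T j∈S j∈T = Dz#Dγ (ι _) (ι∈ j∈S) (ι∈ j∈T)

      C₁ = T ∪ ⁅ b ⁆

      S∩C₁⊆b : ∀ j → j ∈ S → j ∈ C₁ → j ≡ b
      S∩C₁⊆b j j∈S j∈C₁ = [ ⊥-elim ∘ S#T j∈S , x∈⁅y⁆⇒x≡y b ]′ (x∈p∪q⁻ T ⁅ b ⁆ j∈C₁)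

      S#ground : ∀ {D} → D ∈ₗ Ds → z ∉ D → Disjoint S (ground D)
      S#ground D∈ z∉D = ground-disjoint (separated Dz∈ D∈ (there here) z∉D)

      rest-circuit : ∀ {D} → D ∈ₗ Ds → γ ∉ D → z ∉ D → Circuit p A (ground D)
      rest-circuit {inside ∷ _ ∷ _} _ γ∉D _ = ⊥-elim (γ∉D here)
      rest-circuit {outside ∷ _ ∷ _} D∈ _ z∉D = plain-or-z-circuit⁻¹ (circuit D∈)
        (λ _ → (λ a∈ → S#ground D∈ z∉D a a∈S a∈) , (λ b∈ → S#ground D∈ z∉D b b∈S b∈))

      C₁#ground : ∀ {D} → D ∈ₗ Ds → γ ∉ D → z ∉ D → Disjoint C₁ (ground D)
      C₁#ground D∈ γ∉D z∉D j j∈C₁ j∈D with x∈p∪q⁻ T ⁅ b ⁆ j∈C₁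
      ... | inj₁ j∈T = ground-disjoint (separated Dγ∈ D∈ here γ∉D) j j∈T j∈D
      ... | inj₂ j∈⁅b⁆ = S#ground D∈ z∉D j (subst (_∈ S) (sym (x∈⁅y⁆⇒x≡y b j∈⁅b⁆)) b∈S) j∈D

      covered : ∀ j → j ∈ S ⊎ j ∈ C₁ ⊎ Any (j ∈_) (map ground Rest)
      covered j with find (covering (ι j))
      ... | D , D∈ , ιj∈D with z ∈? D | γ ∈? D
      ...   | yes z∈D | _ = inj₁ (ι∈⁻ (∈-transfer D∈ Dz∈ z∈D (there here) ιj∈D))
      ...   | no _ | yes γ∈D = inj₂ (inj₁ (x∈p∪q⁺ (inj₁ (ι∈⁻ (∈-transfer D∈ Dγ∈ γ∈D here ιj∈D)))))
      ...   | no z∉D | no γ∉D =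
        inj₂ (inj₂ (lose (∈-map⁺ ground (∈-filter⁺ γz-free? D∈ (γ∉D , z∉D))) (ι∈⁻ ιj∈D)))

      collection : CircuitCollection
      collection =
        let c , coefficients , cab≉0 = np in
        S , C₁ , map ground Rest ,
        (plain-or-z-circuit⁻¹ (circuit Dz∈) (λ z∉ → ⊥-elim (z∉ (there here))) ,
         inj₂ (inj₂ (a∈S , b∈S , c , RA.coefficients⇒CircuitCoeffs coefficients , cab≉0 ∘ mk≈))) ,
        a∈S , b∈S ,
        γ-circuit⁻¹ (circuit Dγ∈) (S#T a∈S) (S#T b∈S) ,
        All.map⁺ (all-rest rest-circuit) ,
        covered ,
        x∈p∪q⁺ (inj₂ (x∈⁅x⁆ b)) ,
        S∩C₁⊆b ,
        All.map⁺ (all-rest λ D∈ _ z∉D → S#ground D∈ z∉D) ,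
        All.map⁺ (all-rest C₁#ground) ,
        AllPairs.map⁺ (AllPairs.filter⁺ γz-free? (AllPairs.map ground-disjoint disjoint))

    collection-from-owners : ∀ {Dz Dγ} → Dz ∈ₗ Ds → z ∈ Dz → Dγ ∈ₗ Ds → γ ∈ Dγ → CircuitCollection
    collection-from-owners {inside ∷ _ ∷ _} Dz∈ z∈Dz _ _ = ⊥-elim (γz-apart Dz∈ here z∈Dz)
    collection-from-owners {outside ∷ _ ∷ _} {_ ∷ inside ∷ _} _ _ Dγ∈ γ∈Dγ =
      ⊥-elim (γz-apart Dγ∈ γ∈Dγ (there here))
    collection-from-owners {outside ∷ _ ∷ _} {_ ∷ outside ∷ _} Dz∈ (there here) Dγ∈ here = collection Dz∈ Dγ∈

    decomposition⇒collection : CircuitCollection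
    decomposition⇒collection =
      let Dz , Dz∈ , z∈Dz = find (covering z)
          Dγ , Dγ∈ , γ∈Dγ = find (covering γ)
      in collection-from-owners Dz∈ z∈Dz Dγ∈ γ∈Dγ

  collection⇒decomposition : CircuitCollection → Eulerian p B
  collection⇒decomposition
    (Cnp , C₁ , Cs , (Cnp-circuit , np) , a∈Cnp , b∈Cnp , C₁-circuit , Cs-circuits , covers ,
     b∈C₁ , Cnp∩C₁⊆b , Cnp#Cs , C₁#Cs , Cs#Cs) =
    Dz ∷ Dγ ∷ map plain Cs ,
    (z-circuit {c = c} Cnp-circuit (RA.CircuitCoeffs⇒coefficients coefficients) (cab≉0 ∘ p∣x-y) ∷
     γ-circuit C₁-circuit b∈C₁ (λ a∈C₁ → a≢b (Cnp∩C₁⊆b a a∈Cnp a∈C₁)) ∷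
     All.map⁺ (All.tabulate λ C∈ → plain-circuit (All.lookup Cs-circuits C∈)
                                     (All.lookup Cnp#Cs C∈ a a∈Cnp) (All.lookup Cnp#Cs C∈ b b∈Cnp))) ,
    ((Dz#Dγ ∷ All.map⁺ (All.map (disjoint-on-E {outside} {inside}) Cnp#Cs)) ∷
     All.map⁺ (All.map (λ C₁#C → disjoint-on-E {inside} {outside} λ j j∈ → C₁#C j (p─q⊆p C₁ ⁅ b ⁆ j∈)) C₁#Cs) ∷
     AllPairs.map⁺ (AllPairs.map (disjoint-on-E {outside} {outside}) Cs#Cs)) ,
    covering
    where
    Dz = outside ∷ inside ∷ Cnp
    Dγ = inside ∷ outside ∷ (C₁ ─ ⁅ b ⁆)
    plain : Subset n → Subset (suc (suc n))
    plain C = outside ∷ outside ∷ C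
    NPCoefficients = Σ (Fin n → ℤ) λ c → CircuitCoeffs p A Cnp c × ¬ (c a + c b ≡ + 0 [mod p ])
    np-coefficients : (a ∈ Cnp × b ∉ Cnp) ⊎ (a ∉ Cnp × b ∈ Cnp) ⊎ (a ∈ Cnp × b ∈ Cnp × NPCoefficients) →
                      NPCoefficients
    np-coefficients (inj₁ (_ , b∉Cnp)) = ⊥-elim (b∉Cnp b∈Cnp)
    np-coefficients (inj₂ (inj₁ (a∉Cnp , _))) = ⊥-elim (a∉Cnp a∈Cnp)
    np-coefficients (inj₂ (inj₂ (_ , _ , np-coeffs))) = np-coeffs
    c = proj₁ (np-coefficients np)
    coefficients = proj₁ (proj₂ (np-coefficients np))
    cab≉0 = proj₂ (proj₂ (np-coefficients np))
    disjoint-on-E : ∀ {r₀ r₁ S T} → Disjoint S T → Disjoint (r₀ ∷ r₁ ∷ S) (plain T)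
    disjoint-on-E S#T z _ (there ())
    disjoint-on-E S#T (ι j) ιj∈ ιj∈′ = S#T j (ι∈⁻ ιj∈) (ι∈⁻ ιj∈′)
    Dz#Dγ : Disjoint Dz Dγ
    Dz#Dγ z _ (there ())
    Dz#Dγ (ι j) ιj∈Dz ιj∈Dγ =
      x∉p─⁅x⁆ b (subst (_∈ C₁ ─ ⁅ b ⁆) (Cnp∩C₁⊆b j (ι∈⁻ ιj∈Dz) (p─q⊆p C₁ ⁅ b ⁆ (ι∈⁻ ιj∈Dγ))) (ι∈⁻ ιj∈Dγ))
    covering : ∀ k → Any (k ∈_) (Dz ∷ Dγ ∷ map plain Cs)
    covering γ = Any.there (Any.here here)
    covering z = Any.here (there here)
    covering (ι j) with covers j
    ... | inj₁ j∈Cnp = Any.here (ι∈ j∈Cnp)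
    ... | inj₂ (inj₁ j∈C₁) = by-cases-on-b {P = λ j → j ∈ C₁ → Any (ι j ∈_) (Dz ∷ Dγ ∷ map plain Cs)}
          (λ _ → Any.here (ι∈ b∈Cnp))
          (λ j≢b j∈C₁ → Any.there (Any.here (ι∈ (x∈p∧x≢y⇒x∈p-y j∈C₁ j≢b))))
          j j∈C₁
    ... | inj₂ (inj₂ j∈Cs) = Any.there (Any.there (Any.map⁺ (Any.map ι∈ j∈Cs)))

theorem4p1 : (p : ℕ) → Prime p → 2 < p →
    {m n : ℕ} (A : Matrix m n) → Simple p A → Coloopless p A →
    (a b : Fin n) → ¬ (a ≡ b) → (α : ℤ) → ¬ (α ≡ + 0 [mod p ]) →
    Eulerian p (Ae A a b α b) ⇔
    (Σ (Subset n) λ Cnp → Σ (Subset n) λ C₁ → Σ (List (Subset n)) λ Cs →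
      NPCircuit p A a b Cnp × a ∈ Cnp × b ∈ Cnp ×
      Circuit p A C₁ × All (Circuit p A) Cs ×
      (∀ j → j ∈ Cnp ⊎ j ∈ C₁ ⊎ Any (j ∈_) Cs) ×
      b ∈ C₁ × (∀ j → j ∈ Cnp → j ∈ C₁ → j ≡ b) ×
      All (Disjoint Cnp) Cs × All (Disjoint C₁) Cs × AllPairs Disjoint Cs)
theorem4p1 p p-prime _ A _ _ a b a≢b α α≉0 = mk⇔
  (λ (Ds , circuits , disjoint , covering) →
     EulerianDecomposition.decomposition⇒collection Ds circuits disjoint covering)
  collection⇒decomposition
  where
  open Splitting p p-prime A a b a≢b α α≉0
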